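{- For $n\ge 3$, the sum indecomposable permutations of length $n$ having at most one sum indecomposable child (i.e., the permutations of length $n$ in $K^{(1)}$) are exactly $n(n-1)\cdots 21$, $1\ominus(12\cdots(n-1))$, and $(12\cdots(n-1))\ominus 1$.
   Context: Permutations are in one-line notation. The sum $\alpha\oplus\beta$ of $\alpha$ (length $k$) and $\beta$ (length $\ell$) is given by $\alpha(i)$ for $i\le k$ and $\beta(i-k)+k$ for $k<i\le k+\ell$; the skew sum $\alpha\ominus\beta$ is given by $\alpha(i)+\ell$ for $i\le k$ and $\beta(i-k)$ for $k<i\le k+\ell$. A nonempty permutation is sum indecomposable if it is not the sum of two nonempty permutations. For an entry $x$ of $\pi$, the child $\pi-x$ is the permutation order isomorphic to $\pi$ with $x$ deleted. For sum indecomposable $\pi$, $K(\pi)$ is the set of sum indecomposable children of $\pi$, and $K^{(m)}$ is the set of sum indecomposable $\pi$ with $|K(\pi)|\le m$. -}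

module Defs where

open import Data.Nat using (ℕ; suc; _+_; _∸_; _<ᵇ_; _<_)
open import Data.Bool using (T)
open import Data.List using (List; []; _∷_; _++_; map; length; upTo; reverse; lookup; removeAt; filterᵇ)
open import Data.List.Relation.Binary.Permutation.Propositional using (_↭_)
open import Data.Fin using (Fin)
open import Data.Product using (Σ; ∃; _×_)
open import Relation.Binary.PropositionalEquality using (_≡_; _≢_)
open import Relation.Nullary using (¬_)

-- Permutations in one-line notation: lists of naturals.
-- The identity 12⋯n.
idPerm : ℕ → List ℕ
idPerm n = map suc (upTo n)

decPerm : ℕ → List ℕ
decPerm n = reverse (idPerm n)

IsPerm : ℕ → List ℕ → Set
IsPerm n π = π ↭ idPerm n

IsPermutation : List ℕ → Set
IsPermutation π = IsPerm (length π) π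

_⊕_ : List ℕ → List ℕ → List ℕ
α ⊕ β = α ++ map (λ b → b + length α) β

_⊖_ : List ℕ → List ℕ → List ℕ
α ⊖ β = map (λ a → a + length β) α ++ β

standardize : List ℕ → List ℕ
standardize l = map (λ y → suc (length (filterᵇ (λ z → z <ᵇ y) l))) l

child : (π : List ℕ) → Fin (length π) → List ℕ
child π i = standardize (removeAt π i)

SumIndecomposable : List ℕ → Set
SumIndecomposable π =
  π ≢ [] × (∀ α β → IsPermutation α → IsPermutation β → α ≢ [] → β ≢ [] → π ≢ α ⊕ β)

InK : List ℕ → List ℕ → Set
InK π σ = SumIndecomposable σ × ∃ (λ (i : Fin (length π)) → σ ≡ child π i)

InK1 : List ℕ → Set
InK1 π = SumIndecomposable π × (∀ σ τ → InK π σ → InK π τ → σ ≡ τ)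

-- A permutation splits as α ⊕ β with |α| = k exactly when its first k entries are 1, …, k, and
-- deleting the entry v and standardizing lowers every larger entry by one. From this one computes
-- that n⋯21, 1 ⊖ 12⋯(n−1) and 12⋯(n−1) ⊖ 1 each have a single indecomposable child.
-- Conversely let π ∈ K⁽¹⁾. If π starts with n, every child obtained by deleting a later entry starts
-- with its own length, so is indecomposable; two adjacent later entries with non-consecutive values
-- would give two different such children, so the rest of π is 12⋯(n−1) or its reverse. The same
-- argument applies to the entries before a final 1. In the remaining case, with first entry a and
-- last entry b, the children π − n, π − 1, π − a, π − b always contain two distinct indecomposable
-- ones: a split of π − n at k forces a ≤ k < b and makes π − b indecomposable, and a split of π − 1
-- makes π − a indecomposable.

module Submission where

open import Defs
open import Data.Bool using (T; true; false; if_then_else_)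
open import Data.Empty using (⊥; ⊥-elim)
open import Data.Fin as Fin using (Fin)
open import Data.List using (List; []; _∷_; _++_; _∷ʳ_; _∷ʳ′_; initLast; [_]; map; length; upTo; downFrom; reverse; lookup; removeAt; filter; filterᵇ; take; drop)
open import Data.List.Membership.Propositional using (_∈_; _∉_)
open import Data.List.Membership.Propositional.Properties using (∈-map⁺; ∈-map⁻; ∈-upTo⁺; ∈-upTo⁻; ∈-++⁺ˡ; ∈-++⁺ʳ; ∈-++⁻; ∈-∃++; ∈-filter⁺)
open import Data.List.Properties
open import Data.List.Relation.Binary.Equality.Propositional using (≋⇒≡)
open import Data.List.Relation.Binary.Permutation.Propositional using (_↭_; ↭-sym; ↭-trans; ↭-refl; ↭-reflexive; ↭⇒↭ₛ)
open import Data.List.Relation.Binary.Permutation.Propositional.Properties using (∈-resp-↭; ↭-length; filter-↭; shift; map⁺; drop-∷; ++-comm; ↭-reverse)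
import Data.List.Relation.Binary.Permutation.Setoid.Properties as PermutationSetoid
open import Data.List.Relation.Unary.All as All using (All; []; _∷_)
open import Data.List.Relation.Unary.All.Properties using () renaming (map⁺ to All-map⁺; map⁻ to All-map⁻)
open import Data.List.Relation.Unary.AllPairs using ([]; _∷_)
open import Data.List.Relation.Unary.Any using (here; there)
open import Data.List.Relation.Unary.Linked as Linked using (Linked; []; [-]; _∷_)
import Data.List.Relation.Unary.Linked.Properties as Linked
open import Data.List.Relation.Unary.Sorted.TotalOrder.Properties using (↗↭↗⇒≋)
open import Data.List.Relation.Unary.Unique.Propositional using (Unique)
import Data.List.Relation.Unary.Unique.Propositional.Properties as Unique
open import Data.Nat using (ℕ; zero; suc; pred; s≤s⁻¹; _+_; _∸_; _≤_; _<_; _≥_; _≤?_; _<?_; _≟_; _<ᵇ_; z≤n; s≤s)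
open import Data.Nat.Properties
open import Data.Product using (∃; ∃₂; _×_; _,_; proj₁; proj₂)
open import Data.Sum as Sum using (_⊎_; inj₁; inj₂)
open import Function using (_∘_; id)
open import Function.Bundles using (_⇔_; mk⇔)
import Relation.Binary.Construct.Flip.EqAndOrd as Flip
open import Relation.Binary.Definitions using (tri<; tri≈; tri>)
open import Relation.Binary.PropositionalEquality using (_≡_; _≢_; refl; sym; trans; cong; cong₂; subst; subst₂; module ≡-Reasoning)
import Relation.Binary.PropositionalEquality as ≡
open import Relation.Nullary using (¬_; Dec; yes; no; _×-dec_; _⊎-dec_)

take-++ˡ : ∀ k (xs : List ℕ) {ys} → k ≤ length xs → take k (xs ++ ys) ≡ take k xs
take-++ˡ zero xs _ = refl
take-++ˡ (suc k) (x ∷ xs) (s≤s k≤) = cong (x ∷_) (take-++ˡ k xs k≤)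

take-length-++ : ∀ (xs : List ℕ) {ys} → take (length xs) (xs ++ ys) ≡ xs
take-length-++ xs = trans (take-++ˡ (length xs) xs ≤-refl) (take-all (length xs) xs ≤-refl)

drop-length-++ : ∀ (xs : List ℕ) {ys} → drop (length xs) (xs ++ ys) ≡ ys
drop-length-++ [] = refl
drop-length-++ (x ∷ xs) = drop-length-++ xs

∈-drop-∷ʳ : ∀ k (xs : List ℕ) {x} → k < length (xs ∷ʳ x) → x ∈ drop k (xs ∷ʳ x)
∈-drop-∷ʳ zero xs _ = ∈-++⁺ʳ xs (here refl)
∈-drop-∷ʳ (suc k) (y ∷ xs) (s≤s k<) = ∈-drop-∷ʳ k xs k<
∈-drop-∷ʳ (suc k) [] (s≤s ())

∷ʳ≢[] : ∀ (xs : List ℕ) {x} → xs ∷ʳ x ≢ []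
∷ʳ≢[] [] ()
∷ʳ≢[] (_ ∷ _) ()

length-nonempty : ∀ {l : List ℕ} → l ≢ [] → 1 ≤ length l
length-nonempty {[]} l≢[] = ⊥-elim (l≢[] refl)
length-nonempty {_ ∷ _} _ = s≤s z≤n

middle-≡ : ∀ (A B : List ℕ) {p q R S} → A ++ p ∷ R ≡ B ++ q ∷ S → length A ≡ length B → p ≡ q
middle-≡ [] [] eq _ = proj₁ (∷-injective eq)
middle-≡ (_ ∷ A) (_ ∷ B) eq |A|≡|B| = middle-≡ A B (proj₂ (∷-injective eq)) (suc-injective |A|≡|B|)

init-split : ∀ P {v : ℕ} Q {init b} → P ++ v ∷ Q ≡ init ∷ʳ b → Q ≢ [] → ∃ λ Q′ → init ≡ P ++ v ∷ Q′
init-split P {v} Q eq Q≢[] with initLast Q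
... | [] = ⊥-elim (Q≢[] refl)
... | Q′ ∷ʳ′ q = Q′ , sym (∷ʳ-injectiveˡ (P ++ v ∷ Q′) _ (trans (++-assoc P (v ∷ Q′) [ q ]) eq))

take-∌⇒≤-length : ∀ k xs {v : ℕ} {ys} → All (_≢ v) (take k (xs ++ v ∷ ys)) → k ≤ length xs
take-∌⇒≤-length zero xs _ = z≤n
take-∌⇒≤-length (suc k) [] (v≢v ∷ _) = ⊥-elim (v≢v refl)
take-∌⇒≤-length (suc k) (x ∷ xs) (_ ∷ rest) = s≤s (take-∌⇒≤-length k xs rest)

take-∋⇒length-< : ∀ k xs {v : ℕ} {ys} → v ∉ xs → v ∈ take k (xs ++ v ∷ ys) → length xs < k
take-∋⇒length-< (suc k) [] _ _ = s≤s z≤n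
take-∋⇒length-< (suc k) (x ∷ xs) v∉ (here v≡x) = ⊥-elim (v∉ (here v≡x))
take-∋⇒length-< (suc k) (x ∷ xs) v∉ (there v∈) = s≤s (take-∋⇒length-< k xs (v∉ ∘ there) v∈)

take-insert : ∀ {P : ℕ → Set} k xs {v ys} → length xs ≤ k →
  All P (take k (xs ++ ys)) → P v → All P (take (suc k) (xs ++ v ∷ ys))
take-insert k [] _ prefix pv = pv ∷ prefix
take-insert (suc k) (x ∷ xs) (s≤s |xs|≤k) (px ∷ prefix) pv = px ∷ take-insert k xs |xs|≤k prefix pv

suc-pred-> : ∀ {v y} → v < y → suc (pred y) ≡ y
suc-pred-> {y = suc _} _ = refl

pred-< : ∀ {a} → 1 ≤ a → pred a < a
pred-< {suc a} _ = ≤-refl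

unique-↭ : ∀ {σ τ : List ℕ} → σ ↭ τ → Unique τ → Unique σ
unique-↭ σ↭τ = PermutationSetoid.Unique-resp-↭ (≡.setoid ℕ) (↭⇒↭ₛ (↭-sym σ↭τ))

↭-increasing⇒≡ : ∀ {xs ys} → Linked _≤_ xs → Linked _≤_ ys → xs ↭ ys → xs ≡ ys
↭-increasing⇒≡ xs↗ ys↗ xs↭ys = ≋⇒≡ (↗↭↗⇒≋ ≤-totalOrder xs↗ ys↗ (↭⇒↭ₛ xs↭ys))

↭-decreasing⇒≡ : ∀ {xs ys} → Linked _≥_ xs → Linked _≥_ ys → xs ↭ ys → xs ≡ ys
↭-decreasing⇒≡ xs↘ ys↘ xs↭ys = ≋⇒≡ (↗↭↗⇒≋ (Flip.totalOrder ≤-totalOrder) xs↘ ys↘ (↭⇒↭ₛ xs↭ys))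

idPerm-suc : ∀ n → idPerm (suc n) ≡ 1 ∷ map suc (idPerm n)
idPerm-suc n = cong (λ l → 1 ∷ map suc l) (sym (map-upTo suc n))

idPerm-∷ʳ : ∀ n → idPerm (suc n) ≡ idPerm n ∷ʳ suc n
idPerm-∷ʳ n = trans (cong (map suc) (sym (upTo-∷ʳ n))) (map-++ suc (upTo n) [ n ])

length-idPerm : ∀ n → length (idPerm n) ≡ n
length-idPerm n = trans (length-map suc (upTo n)) (length-upTo n)

decPerm-suc : ∀ n → decPerm (suc n) ≡ suc n ∷ decPerm n
decPerm-suc n = trans (cong reverse (idPerm-∷ʳ n)) (reverse-++ (idPerm n) [ suc n ])

decPerm-suc-∷ʳ : ∀ n → decPerm (suc n) ≡ map suc (decPerm n) ∷ʳ 1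
decPerm-suc-∷ʳ n = begin
  reverse (idPerm (suc n))           ≡⟨ cong reverse (idPerm-suc n) ⟩
  reverse (1 ∷ map suc (idPerm n))   ≡⟨ unfold-reverse 1 (map suc (idPerm n)) ⟩
  reverse (map suc (idPerm n)) ∷ʳ 1  ≡⟨ cong (_∷ʳ 1) (sym (reverse-map suc (idPerm n))) ⟩
  map suc (decPerm n) ∷ʳ 1           ∎
  where open ≡-Reasoning

idPerm-↭-max∷ : ∀ n → idPerm (suc n) ↭ suc n ∷ idPerm n
idPerm-↭-max∷ n = subst (_↭ suc n ∷ idPerm n) (sym (idPerm-∷ʳ n)) (++-comm (idPerm n) [ suc n ])

length-decPerm : ∀ n → length (decPerm n) ≡ n
length-decPerm n = trans (length-reverse (idPerm n)) (length-idPerm n)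

∈-idPerm⁺ : ∀ {n y} → 1 ≤ y → y ≤ n → y ∈ idPerm n
∈-idPerm⁺ {y = suc y} _ y≤n = ∈-map⁺ suc (∈-upTo⁺ y≤n)

∈-idPerm⁻ : ∀ {n y} → y ∈ idPerm n → 1 ≤ y × y ≤ n
∈-idPerm⁻ y∈ with ∈-map⁻ suc y∈
... | x , x∈ , refl = s≤s z≤n , ∈-upTo⁻ x∈

unique-idPerm : ∀ n → Unique (idPerm n)
unique-idPerm n = Unique.map⁺ suc-injective (Unique.upTo⁺ n)

idPerm-+ : ∀ k m → idPerm (k + m) ≡ idPerm k ++ map (_+ k) (idPerm m)
idPerm-+ k zero = trans (cong idPerm (+-identityʳ k)) (sym (++-identityʳ (idPerm k)))
idPerm-+ k (suc m) = begin
  idPerm (k + suc m)                                      ≡⟨ cong idPerm (+-suc k m) ⟩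
  idPerm (suc (k + m))                                    ≡⟨ idPerm-∷ʳ (k + m) ⟩
  idPerm (k + m) ∷ʳ suc (k + m)                           ≡⟨ cong₂ _∷ʳ_ (idPerm-+ k m) (cong suc (+-comm k m)) ⟩
  (idPerm k ++ map (_+ k) (idPerm m)) ∷ʳ (suc m + k)       ≡⟨ ++-assoc (idPerm k) _ _ ⟩
  idPerm k ++ (map (_+ k) (idPerm m) ∷ʳ (suc m + k))      ≡⟨ cong (idPerm k ++_) (sym (map-++ (_+ k) (idPerm m) [ suc m ])) ⟩
  idPerm k ++ map (_+ k) (idPerm m ∷ʳ suc m)              ≡⟨ cong (λ l → idPerm k ++ map (_+ k) l) (sym (idPerm-∷ʳ m)) ⟩
  idPerm k ++ map (_+ k) (idPerm (suc m))                 ∎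
  where open ≡-Reasoning

filter-≤-idPerm : ∀ {t n} → t ≤ n → filter (_≤? t) (idPerm n) ≡ idPerm t
filter-≤-idPerm {t} {n} t≤n = begin
  filter (_≤? t) (idPerm n)                               ≡⟨ cong (filter (_≤? t) ∘ idPerm) (sym (m+[n∸m]≡n t≤n)) ⟩
  filter (_≤? t) (idPerm (t + (n ∸ t)))                   ≡⟨ cong (filter (_≤? t)) (idPerm-+ t (n ∸ t)) ⟩
  filter (_≤? t) (idPerm t ++ map (_+ t) (idPerm (n ∸ t))) ≡⟨ filter-++ (_≤? t) (idPerm t) _ ⟩
  filter (_≤? t) (idPerm t) ++ filter (_≤? t) (map (_+ t) (idPerm (n ∸ t)))
    ≡⟨ cong₂ _++_ (filter-all (_≤? t) (All.tabulate (proj₂ ∘ ∈-idPerm⁻)))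
                  (filter-none (_≤? t) (All.tabulate above)) ⟩
  idPerm t ++ []                                          ≡⟨ ++-identityʳ (idPerm t) ⟩
  idPerm t                                                ∎
  where
  open ≡-Reasoning
  above : ∀ {y} → y ∈ map (_+ t) (idPerm (n ∸ t)) → ¬ y ≤ t
  above y∈ with ∈-map⁻ (_+ t) y∈
  ... | x , x∈ , refl = <⇒≱ (+-monoˡ-≤ t (proj₁ (∈-idPerm⁻ x∈)))

filter->-idPerm : ∀ {t n} → t ≤ n → filter (t <?_) (idPerm n) ≡ map (_+ t) (idPerm (n ∸ t))
filter->-idPerm {t} {n} t≤n = begin
  filter (t <?_) (idPerm n)                               ≡⟨ cong (filter (t <?_) ∘ idPerm) (sym (m+[n∸m]≡n t≤n)) ⟩
  filter (t <?_) (idPerm (t + (n ∸ t)))                   ≡⟨ cong (filter (t <?_)) (idPerm-+ t (n ∸ t)) ⟩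
  filter (t <?_) (idPerm t ++ map (_+ t) (idPerm (n ∸ t))) ≡⟨ filter-++ (t <?_) (idPerm t) _ ⟩
  filter (t <?_) (idPerm t) ++ filter (t <?_) (map (_+ t) (idPerm (n ∸ t)))
    ≡⟨ cong₂ _++_ (filter-none (t <?_) (All.tabulate (≤⇒≯ ∘ proj₂ ∘ ∈-idPerm⁻)))
                  (filter-all (t <?_) (All.tabulate above)) ⟩
  map (_+ t) (idPerm (n ∸ t))                             ∎
  where
  open ≡-Reasoning
  above : ∀ {y} → y ∈ map (_+ t) (idPerm (n ∸ t)) → t < y
  above y∈ with ∈-map⁻ (_+ t) y∈
  ... | x , x∈ , refl = +-monoˡ-≤ t (proj₁ (∈-idPerm⁻ x∈))

[1]⊖idPerm : ∀ n → [ 1 ] ⊖ idPerm n ≡ suc n ∷ idPerm n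
[1]⊖idPerm n = cong (λ k → suc k ∷ idPerm n) (length-idPerm n)

idPerm⊖[1] : ∀ n → idPerm n ⊖ [ 1 ] ≡ map suc (idPerm n) ∷ʳ 1
idPerm⊖[1] n = cong (_∷ʳ 1) (map-cong (λ k → +-comm k 1) (idPerm n))

idPerm-increasing : ∀ m → Linked _≤_ (idPerm m)
idPerm-increasing m = Linked.map⁺ (Linked.applyUpTo⁺₂ id m (λ i → s≤s (n≤1+n i)))

decPerm-decreasing : ∀ m → Linked _≥_ (decPerm m)
decPerm-decreasing m =
  subst (Linked _≥_) downward (Linked.map⁺ (Linked.applyDownFrom⁺₂ id m (λ i → s≤s (n≤1+n i))))
  where
  downward : map suc (downFrom m) ≡ decPerm m
  downward = trans (cong (map suc) (sym (reverse-upTo m))) (reverse-map suc (upTo m))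

module _ {n π} (π↭ : π ↭ idPerm n) where

  ∈-perm⁺ : ∀ {y} → 1 ≤ y → y ≤ n → y ∈ π
  ∈-perm⁺ 1≤y y≤n = ∈-resp-↭ (↭-sym π↭) (∈-idPerm⁺ 1≤y y≤n)

  ∈-perm⁻ : ∀ {y} → y ∈ π → 1 ≤ y × y ≤ n
  ∈-perm⁻ = ∈-idPerm⁻ ∘ ∈-resp-↭ π↭

  length-perm : length π ≡ n
  length-perm = trans (↭-length π↭) (length-idPerm n)

  deleted-∉ : ∀ {xs v ys} → π ≡ xs ++ v ∷ ys → v ∉ xs ++ ys
  deleted-∉ {xs} {v} {ys} refl =
    Unique.Unique[x∷xs]⇒x∉xs (unique-↭ (↭-trans (↭-sym (shift v xs ys)) π↭) (unique-idPerm n))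

-- Children

lower : ℕ → ℕ → ℕ
lower v y = if v <ᵇ y then pred y else y

lower-> : ∀ {v y} → v < y → lower v y ≡ pred y
lower-> {v} {y} v<y with v <ᵇ y | <⇒<ᵇ v<y
... | true | _ = refl

lower-≤ : ∀ {v y} → y ≤ v → lower v y ≡ y
lower-≤ {v} {y} y≤v with v <ᵇ y | <ᵇ⇒< v y
... | false | _ = refl
... | true | v<y = ⊥-elim (<⇒≱ (v<y _) y≤v)

lower-cases : ∀ v y → (v < y × lower v y ≡ pred y) ⊎ (y ≤ v × lower v y ≡ y)
lower-cases v y with v <? y
... | yes v<y = inj₁ (v<y , lower-> v<y)
... | no v≮y = inj₂ (≮⇒≥ v≮y , lower-≤ (≮⇒≥ v≮y))

lower-≤-self : ∀ v y → lower v y ≤ y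
lower-≤-self v y with lower-cases v y
... | inj₁ (_ , eq) = ≤-trans (≤-reflexive eq) pred[n]≤n
... | inj₂ (_ , eq) = ≤-reflexive eq

lower-≤⇒≤-suc : ∀ {v y k} → lower v y ≤ k → y ≤ suc k
lower-≤⇒≤-suc {v} {y} le with lower-cases v y
... | inj₁ (v<y , eq) = subst (_≤ _) (suc-pred-> v<y) (s≤s (subst (_≤ _) eq le))
... | inj₂ (_ , eq) = m≤n⇒m≤1+n (subst (_≤ _) eq le)

lower-≤⇒≤ : ∀ {v y k} → k < v → lower v y ≤ k → y ≤ k
lower-≤⇒≤ {v} {y} k<v le with lower-cases v y
... | inj₁ (v<y , eq) = ⊥-elim (<⇒≱ k<v (≤-trans (pred-mono-≤ v<y) (subst (_≤ _) eq le)))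
... | inj₂ (_ , eq) = subst (_≤ _) eq le

lower-suc : ∀ w y → lower (suc w) (suc y) ≡ suc (lower w y)
lower-suc w y with lower-cases w y
... | inj₁ (w<y , eq) = trans (lower-> (s≤s w<y)) (trans (sym (suc-pred-> w<y)) (cong suc (sym eq)))
... | inj₂ (y≤w , eq) = trans (lower-≤ (s≤s y≤w)) (cong suc (sym eq))

lower-< : ∀ {a y m} → a < m → y ≤ m → lower a y < m
lower-< {a} {y} a<m y≤m with lower-cases a y
... | inj₁ (a<y , eq) = subst (_< _) (sym eq) (≤-trans (≤-reflexive (suc-pred-> a<y)) y≤m)
... | inj₂ (y≤a , eq) = subst (_< _) (sym eq) (≤-<-trans y≤a a<m)

count : ℕ → List ℕ → ℕ
count y l = length (filterᵇ (_<ᵇ y) l)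

count-idPerm : ∀ {n y} → 1 ≤ y → y ≤ n → count y (idPerm n) ≡ pred y
count-idPerm {n} {suc y} _ y<n = begin
  length (filterᵇ (_<ᵇ suc y) (idPerm n)) ≡⟨ cong length (filter-≐ _ (_≤? y) (<ᵇ⇒≤ , ≤⇒<ᵇ) (idPerm n)) ⟩
  length (filter (_≤? y) (idPerm n))      ≡⟨ cong length (filter-≤-idPerm (<⇒≤ y<n)) ⟩
  length (idPerm y)                       ≡⟨ length-idPerm y ⟩
  y                                       ∎
  where
  open ≡-Reasoning
  <ᵇ⇒≤ : ∀ {z} → T (z <ᵇ suc y) → z ≤ y
  <ᵇ⇒≤ {z} t = ≤-pred (<ᵇ⇒< z (suc y) t)
  ≤⇒<ᵇ : ∀ {z} → z ≤ y → T (z <ᵇ suc y)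
  ≤⇒<ᵇ z≤y = <⇒<ᵇ (s≤s z≤y)

standardize-tail : ∀ {n v l} → (v ∷ l) ↭ idPerm n → standardize l ≡ map (lower v) l
standardize-tail {n} {v} {l} v∷l↭ = map-cong-local (All.tabulate (λ y∈l → rank (∈-perm⁻ v∷l↭ (there y∈l))))
  where
  rank : ∀ {y} → 1 ≤ y × y ≤ n → suc (count y l) ≡ lower v y
  rank {y} (1≤y , y≤n) with v <ᵇ y | trans (↭-length (filter-↭ _ v∷l↭)) (count-idPerm 1≤y y≤n)
  ... | true  | total = total
  ... | false | total = trans (cong suc total) (suc-pred-> 1≤y)

-- The child π − v of π = xs ++ v ∷ ys.
delete : List ℕ → ℕ → List ℕ → List ℕ
delete xs v ys = map (lower v) (xs ++ ys)

removeAt-split : (l : List ℕ) (i : Fin (length l)) →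
  ∃₂ λ xs ys → l ≡ xs ++ lookup l i ∷ ys × removeAt l i ≡ xs ++ ys
removeAt-split (x ∷ l) Fin.zero = [] , l , refl , refl
removeAt-split (x ∷ l) (Fin.suc i) with removeAt-split l i
... | xs , ys , l≡ , removed≡ = x ∷ xs , ys , cong (x ∷_) l≡ , cong (x ∷_) removed≡

removeAt-index : ∀ xs (v : ℕ) ys →
  ∃ λ (i : Fin (length (xs ++ v ∷ ys))) → removeAt (xs ++ v ∷ ys) i ≡ xs ++ ys
removeAt-index [] v ys = Fin.zero , refl
removeAt-index (x ∷ xs) v ys with removeAt-index xs v ys
... | i , removed≡ = Fin.suc i , cong (x ∷_) removed≡

module _ {n π} (π↭ : π ↭ idPerm n) where

  child-deleting : ∀ {xs v ys} → π ≡ xs ++ v ∷ ys → ∃ λ i → child π i ≡ delete xs v ys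
  child-deleting {xs} {v} {ys} refl with removeAt-index xs v ys
  ... | i , removed≡ =
    i , trans (cong standardize removed≡) (standardize-tail (↭-trans (↭-sym (shift v xs ys)) π↭))

  child-view : ∀ i → ∃₂ λ xs ys → ∃ λ v → π ≡ xs ++ v ∷ ys × child π i ≡ delete xs v ys
  child-view i with removeAt-split π i
  ... | xs , ys , π≡ , removed≡ = xs , ys , lookup π i , π≡ ,
    trans (cong standardize removed≡)
          (standardize-tail (↭-trans (↭-sym (shift _ xs ys)) (subst (_↭ idPerm n) π≡ π↭)))

map-lower-≤ : ∀ {v l} → All (_≤ v) l → map (lower v) l ≡ l
map-lower-≤ = map-id-local ∘ All.map lower-≤

delete-∷ʳ : ∀ xs v ys y → delete xs v (ys ∷ʳ y) ≡ delete xs v ys ∷ʳ lower v y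
delete-∷ʳ xs v ys y = trans (cong (map (lower v)) (sym (++-assoc xs ys [ y ]))) (map-++ (lower v) (xs ++ ys) [ y ])

delete-map-suc : ∀ A w B → delete (map suc A) (suc w) (map suc B) ≡ map suc (delete A w B)
delete-map-suc A w B = begin
  map (lower (suc w)) (map suc A ++ map suc B) ≡⟨ cong (map (lower (suc w))) (sym (map-++ suc A B)) ⟩
  map (lower (suc w)) (map suc (A ++ B))      ≡⟨ sym (map-∘ (A ++ B)) ⟩
  map (lower (suc w) ∘ suc) (A ++ B)          ≡⟨ map-cong (lower-suc w) (A ++ B) ⟩
  map (suc ∘ lower w) (A ++ B)                ≡⟨ map-∘ (A ++ B) ⟩
  map suc (delete A w B)                      ∎
  where open ≡-Reasoning

length-delete : ∀ xs v ys → length (xs ++ v ∷ ys) ≡ suc (length (delete xs v ys))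
length-delete xs v ys = trans (length-++-sucʳ xs v ys) (cong suc (sym (length-map (lower v) (xs ++ ys))))

delete-head : ∀ {a rest} xs {v ys} → a ∷ rest ≡ xs ++ v ∷ ys → a ≢ v → ∃ λ σ → delete xs v ys ≡ lower v a ∷ σ
delete-head [] eq a≢v = ⊥-elim (a≢v (proj₁ (∷-injective eq)))
delete-head (x ∷ xs) {v} {ys} eq _ with ∷-injective eq
... | refl , _ = delete xs v ys , refl

delete-last : ∀ {init b} xs {v} ys → init ∷ʳ b ≡ xs ++ v ∷ ys → b ≢ v → ∃ λ σ → delete xs v ys ≡ σ ∷ʳ lower v b
delete-last {init} xs {v} ys eq b≢v with initLast ys
... | [] = ⊥-elim (b≢v (∷ʳ-injectiveʳ init xs eq))
... | ys′ ∷ʳ′ y with ∷ʳ-injective init (xs ++ v ∷ ys′) (trans eq (sym (++-assoc xs (v ∷ ys′) [ y ])))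
...   | _ , refl = delete xs v ys′ , delete-∷ʳ xs v ys′ y

-- Sum decompositions

-- For a permutation σ, SplitsAt σ k says that σ = α ⊕ β with length α ≡ k.
SplitsAt : List ℕ → ℕ → Set
SplitsAt σ k = All (_≤ k) (take k σ) × All (k <_) (drop k σ)

Splittable : List ℕ → Set
Splittable σ = ∃ λ k → k < length σ × 1 ≤ k × SplitsAt σ k

splittable? : ∀ σ → Dec (Splittable σ)
splittable? σ = anyUpTo? (λ k → (1 ≤? k) ×-dec splitsAt? k) (length σ)
  where
  splitsAt? : ∀ k → Dec (SplitsAt σ k)
  splitsAt? k = All.all? (_≤? k) (take k σ) ×-dec All.all? (k <?_) (drop k σ)

⊕-splittable : ∀ {α β} → IsPermutation α → IsPermutation β → α ≢ [] → β ≢ [] → Splittable (α ⊕ β)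
⊕-splittable {α} {β} α↭ β↭ α≢[] β≢[] = length α , |α|<|α⊕β| , length-nonempty α≢[] , prefix , suffix
  where
  |α|<|α⊕β| : length α < length (α ⊕ β)
  |α|<|α⊕β| = subst (length α <_) (sym (trans (length-++ α) (cong (length α +_) (length-map _ β))))
                (m<m+n (length α) (length-nonempty β≢[]))
  prefix : All (_≤ length α) (take (length α) (α ⊕ β))
  prefix = subst (All (_≤ length α)) (sym (take-length-++ α)) (All.tabulate (proj₂ ∘ ∈-perm⁻ α↭))
  suffix : All (length α <_) (drop (length α) (α ⊕ β))
  suffix = subst (All (length α <_)) (sym (drop-length-++ α))
             (All-map⁺ (All.tabulate (λ b∈ → +-monoˡ-≤ (length α) (proj₁ (∈-perm⁻ β↭ b∈)))))

unsplittable⇒indecomposable : ∀ {σ} → σ ≢ [] → ¬ Splittable σ → SumIndecomposable σ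
unsplittable⇒indecomposable σ≢[] ¬split = σ≢[] , λ α β α↭ β↭ α≢[] β≢[] σ≡α⊕β →
  ¬split (subst Splittable (sym σ≡α⊕β) (⊕-splittable α↭ β↭ α≢[] β≢[]))

splitsAt-head : ∀ {x σ k} → 1 ≤ k → SplitsAt (x ∷ σ) k → x ≤ k
splitsAt-head (s≤s _) (x≤k ∷ _ , _) = x≤k

splitsAt-last : ∀ {σ x k} → k < length (σ ∷ʳ x) → SplitsAt (σ ∷ʳ x) k → k < x
splitsAt-last {σ} k< (_ , suffix) = All.lookup suffix (∈-drop-∷ʳ _ σ k<)

unsplittable-head : ∀ {x σ} → length σ < x → ¬ Splittable (x ∷ σ)
unsplittable-head |σ|<x (k , s≤s k≤|σ| , 1≤k , split) = <⇒≱ (≤-<-trans k≤|σ| |σ|<x) (splitsAt-head 1≤k split)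

unsplittable-last : ∀ {σ x} → x ≤ 1 → ¬ Splittable (σ ∷ʳ x)
unsplittable-last x≤1 (k , k< , 1≤k , split) = <⇒≱ (≤-trans (s≤s 1≤k) (splitsAt-last k< split)) x≤1

module _ {n π k} (π↭ : π ↭ idPerm n) (k≤n : k ≤ n) (prefix : All (_≤ k) (take k π)) where

  private
    α = take k π
    γ = drop k π

  length-boundedPrefix : length α ≡ k
  length-boundedPrefix = trans (length-take k π) (m≤n⇒m⊓n≡m (subst (k ≤_) (sym (length-perm π↭)) k≤n))

  -- The entries ≤ k of π are exactly 1, …, k, and α already contains k of them.
  boundedPrefix-rest : All (k <_) γ
  boundedPrefix-rest =
    All.tabulate (λ y∈γ → ≰⇒> (λ y≤k → ∉[] (subst (_ ∈_) no-small (∈-filter⁺ (_≤? k) y∈γ y≤k))))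
    where
    ∉[] : ∀ {y : ℕ} → ¬ y ∈ []
    ∉[] ()
    empty : ∀ {l : List ℕ} → length l ≡ 0 → l ≡ []
    empty {[]} _ = refl
    small : filter (_≤? k) π ≡ α ++ filter (_≤? k) γ
    small = trans (cong (filter (_≤? k)) (sym (take++drop≡id k π)))
                  (trans (filter-++ (_≤? k) α γ) (cong (_++ filter (_≤? k) γ) (filter-all (_≤? k) prefix)))
    no-small : filter (_≤? k) γ ≡ []
    no-small = empty (+-cancelˡ-≡ k _ 0 (begin
      k + length (filter (_≤? k) γ)        ≡⟨ cong (_+ length (filter (_≤? k) γ)) (sym length-boundedPrefix) ⟩
      length α + length (filter (_≤? k) γ)  ≡⟨ sym (trans (cong length small) (length-++ α)) ⟩
      length (filter (_≤? k) π)            ≡⟨ ↭-length (subst (_ ↭_) (filter-≤-idPerm k≤n) (filter-↭ (_≤? k) π↭)) ⟩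
      length (idPerm k)                    ≡⟨ trans (length-idPerm k) (sym (+-identityʳ k)) ⟩
      k + 0                                ∎))
      where open ≡-Reasoning

  boundedPrefix-perm : α ↭ idPerm k
  boundedPrefix-perm = subst₂ _↭_ small-entries (filter-≤-idPerm k≤n) (filter-↭ (_≤? k) π↭)
    where
    small-entries : filter (_≤? k) π ≡ α
    small-entries = begin
      filter (_≤? k) π                                 ≡⟨ cong (filter (_≤? k)) (sym (take++drop≡id k π)) ⟩
      filter (_≤? k) (α ++ γ)                          ≡⟨ filter-++ (_≤? k) α γ ⟩
      filter (_≤? k) α ++ filter (_≤? k) γ
        ≡⟨ cong₂ _++_ (filter-all (_≤? k) prefix) (filter-none (_≤? k) (All.map <⇒≱ boundedPrefix-rest)) ⟩
      α ++ []                                          ≡⟨ ++-identityʳ α ⟩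
      α                                                ∎
      where open ≡-Reasoning

  boundedPrefix-rest-perm : γ ↭ map (_+ k) (idPerm (n ∸ k))
  boundedPrefix-rest-perm = subst₂ _↭_ large-entries (filter->-idPerm k≤n) (filter-↭ (k <?_) π↭)
    where
    large-entries : filter (k <?_) π ≡ γ
    large-entries = begin
      filter (k <?_) π                                 ≡⟨ cong (filter (k <?_)) (sym (take++drop≡id k π)) ⟩
      filter (k <?_) (α ++ γ)                          ≡⟨ filter-++ (k <?_) α γ ⟩
      filter (k <?_) α ++ filter (k <?_) γ
        ≡⟨ cong₂ _++_ (filter-none (k <?_) (All.map ≤⇒≯ prefix)) (filter-all (k <?_) boundedPrefix-rest) ⟩
      γ                                                ∎
      where open ≡-Reasoning

boundedPrefix⇒decomposable : ∀ {n π k} → π ↭ idPerm n → 1 ≤ k → k < n → All (_≤ k) (take k π) →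
  ¬ SumIndecomposable π
boundedPrefix⇒decomposable {n} {π} {k} π↭ 1≤k k<n prefix (_ , indecomposable) =
  indecomposable α β α↭ β↭ α≢[] β≢[] π≡α⊕β
  where
  α = take k π
  γ = drop k π
  β = map (_∸ k) γ
  |α| : length α ≡ k
  |α| = length-boundedPrefix π↭ (<⇒≤ k<n) prefix
  |β| : length β ≡ n ∸ k
  |β| = trans (length-map _ γ) (trans (length-drop k π) (cong (_∸ k) (length-perm π↭)))
  α↭ : IsPermutation α
  α↭ = subst (λ m → α ↭ idPerm m) (sym |α|) (boundedPrefix-perm π↭ (<⇒≤ k<n) prefix)
  β↭ : IsPermutation β
  β↭ = subst (λ m → β ↭ idPerm m) (sym |β|)
         (subst (β ↭_) (map-∸-+ (idPerm (n ∸ k))) (map⁺ (_∸ k) (boundedPrefix-rest-perm π↭ (<⇒≤ k<n) prefix)))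
    where
    map-∸-+ : ∀ l → map (_∸ k) (map (_+ k) l) ≡ l
    map-∸-+ l = trans (sym (map-∘ l)) (map-id-local (All.tabulate (λ {x} _ → m+n∸n≡m x k)))
  π≡α⊕β : π ≡ α ⊕ β
  π≡α⊕β = trans (sym (take++drop≡id k π)) (cong (α ++_) (sym restore))
    where
    restore : map (_+ length α) β ≡ γ
    restore = trans (sym (map-∘ γ)) (map-id-local (All.map ∸+≡ (boundedPrefix-rest π↭ (<⇒≤ k<n) prefix)))
      where
      ∸+≡ : ∀ {y} → k < y → y ∸ k + length α ≡ y
      ∸+≡ {y} k<y = trans (cong (y ∸ k +_) |α|) (m∸n+n≡m (<⇒≤ k<y))
  α≢[] : α ≢ []
  α≢[] α≡[] = <⇒≱ 1≤k (≤-reflexive (trans (sym |α|) (cong length α≡[])))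
  β≢[] : β ≢ []
  β≢[] β≡[] = <⇒≱ (m<n⇒0<n∸m k<n) (≤-reflexive (trans (sym |β|) (cong length β≡[])))

module _ {k} xs v ys (prefix : All (_≤ k) (take k (delete xs v ys))) where

  private
    lowered : All (λ y → lower v y ≤ k) (take k (xs ++ ys))
    lowered = All-map⁻ (subst (All (_≤ k)) (take-map k (xs ++ ys)) prefix)

  prefix-before-deleted : k ≤ length xs → All (λ y → lower v y ≤ k) (take k (xs ++ v ∷ ys))
  prefix-before-deleted k≤|xs| = subst (All _) (trans (take-++ˡ k xs k≤|xs|) (sym (take-++ˡ k xs k≤|xs|))) lowered

  prefix-with-deleted : length xs ≤ k → v ≤ suc k → All (_≤ suc k) (take (suc k) (xs ++ v ∷ ys))
  prefix-with-deleted |xs|≤k v≤ = take-insert k xs |xs|≤k (All.map lower-≤⇒≤-suc lowered) v≤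

module _ {n π} (π↭ : π ↭ idPerm n) (indecomposable : SumIndecomposable π) where

  indecomposable-head≢1 : 1 < n → ∀ {τ} → π ≢ 1 ∷ τ
  indecomposable-head≢1 1<n refl = boundedPrefix⇒decomposable π↭ ≤-refl 1<n (≤-refl ∷ []) indecomposable

  indecomposable-last≢max : 1 < n → ∀ {init} → π ≢ init ∷ʳ n
  indecomposable-last≢max 1<n {init} refl = boundedPrefix⇒decomposable π↭ 1≤|init| |init|<n prefix indecomposable
    where
    |init|≡ : suc (length init) ≡ n
    |init|≡ = trans (trans (+-comm 1 (length init)) (sym (length-++ init))) (length-perm π↭)
    1≤|init| : 1 ≤ length init
    1≤|init| = s≤s⁻¹ (subst (2 ≤_) (sym |init|≡) 1<n)
    |init|<n : length init < n
    |init|<n = ≤-reflexive |init|≡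
    below-max : ∀ {y} → y ∈ init → y ≤ length init
    below-max {y} y∈ = s≤s⁻¹ (subst (y <_) (sym |init|≡) (≤∧≢⇒< (proj₂ (∈-perm⁻ π↭ (∈-++⁺ˡ y∈))) y≢n))
      where
      y≢n : y ≢ n
      y≢n refl = deleted-∉ π↭ {init} {ys = []} refl (∈-++⁺ˡ y∈)
    prefix : All (_≤ length init) (take (length init) (init ∷ʳ n))
    prefix = subst (All (_≤ length init)) (sym (take-length-++ init)) (All.tabulate below-max)

-- The three permutations lie in K⁽¹⁾

map-suc-split : ∀ L xs (v : ℕ) ys → map suc L ≡ xs ++ v ∷ ys →
  ∃₂ λ A B → ∃ λ w → L ≡ A ++ w ∷ B × xs ≡ map suc A × v ≡ suc w × ys ≡ map suc B
map-suc-split (l ∷ L) [] v ys eq with ∷-injective eq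
... | refl , refl = [] , L , l , refl , refl , refl , refl
map-suc-split (l ∷ L) (x ∷ xs) v ys eq with ∷-injective eq
... | refl , eq′ with map-suc-split L xs v ys eq′
...   | A , B , w , L≡ , refl , refl , refl = l ∷ A , B , w , cong (l ∷_) L≡ , refl , refl , refl

lower-1-suc-idPerm : ∀ m → map (lower 1) (map suc (idPerm m)) ≡ idPerm m
lower-1-suc-idPerm m =
  trans (sym (map-∘ (idPerm m))) (map-id-local (All.tabulate (lower-> ∘ s≤s ∘ proj₁ ∘ ∈-idPerm⁻)))

delete-idPerm : ∀ m xs v ys → idPerm (suc m) ≡ xs ++ v ∷ ys → delete xs v ys ≡ idPerm m
delete-idPerm m [] v ys eq with ∷-injective (trans (sym (idPerm-suc m)) eq)
... | refl , refl = lower-1-suc-idPerm m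
delete-idPerm zero (x ∷ xs) v ys eq with ∷-injective (trans (sym (idPerm-suc zero)) eq)
delete-idPerm zero (x ∷ []) v ys eq | refl , ()
delete-idPerm zero (x ∷ _ ∷ _) v ys eq | refl , ()
delete-idPerm (suc m) (x ∷ xs) v ys eq with ∷-injective (trans (sym (idPerm-suc (suc m))) eq)
... | refl , eq′ with map-suc-split (idPerm (suc m)) xs v ys eq′
...   | A , B , w , id≡ , refl , refl , refl = begin
  lower (suc w) 1 ∷ delete (map suc A) (suc w) (map suc B)
    ≡⟨ cong₂ _∷_ (lower-≤ {suc w} (s≤s z≤n)) (delete-map-suc A w B) ⟩
  1 ∷ map suc (delete A w B)
    ≡⟨ cong (λ l → 1 ∷ map suc l) (delete-idPerm m A w B id≡) ⟩
  1 ∷ map suc (idPerm m)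
    ≡⟨ sym (idPerm-suc m) ⟩
  idPerm (suc m)
    ∎
  where open ≡-Reasoning

delete-decPerm : ∀ m xs v ys → decPerm (suc m) ≡ xs ++ v ∷ ys → delete xs v ys ≡ decPerm m
delete-decPerm m [] v ys eq with ∷-injective (trans (sym (decPerm-suc m)) eq)
... | refl , refl = map-lower-≤ (All.tabulate (m≤n⇒m≤1+n ∘ proj₂ ∘ ∈-perm⁻ (↭-reverse (idPerm m))))
delete-decPerm zero (x ∷ xs) v ys eq with ∷-injective (trans (sym (decPerm-suc zero)) eq)
delete-decPerm zero (x ∷ []) v ys eq | refl , ()
delete-decPerm zero (x ∷ _ ∷ _) v ys eq | refl , ()
delete-decPerm (suc m) (x ∷ xs) v ys eq with ∷-injective (trans (sym (decPerm-suc (suc m))) eq)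
... | refl , eq′ = trans (cong₂ _∷_ (lower-> (s≤s v≤)) (delete-decPerm m xs v ys eq′)) (sym (decPerm-suc m))
  where
  v≤ : v ≤ suc m
  v≤ = proj₂ (∈-perm⁻ (↭-reverse (idPerm (suc m))) (subst (v ∈_) (sym eq′) (∈-++⁺ʳ xs (here refl))))

idPerm-decomposable : ∀ j → ¬ SumIndecomposable (idPerm (suc (suc j)))
idPerm-decomposable j (_ , indecomposable) = indecomposable [ 1 ] (idPerm (suc j)) ↭-refl tail↭ (λ ()) (λ ()) split
  where
  tail↭ : IsPermutation (idPerm (suc j))
  tail↭ = subst (λ m → idPerm (suc j) ↭ idPerm m) (sym (length-idPerm (suc j))) ↭-refl
  split : idPerm (suc (suc j)) ≡ [ 1 ] ⊕ idPerm (suc j)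
  split = trans (idPerm-suc (suc j)) (cong (1 ∷_) (map-cong (λ b → +-comm 1 b) (idPerm (suc j))))

K1-of-unique-child : ∀ {n π} → π ↭ idPerm n → SumIndecomposable π → ∀ c →
  (∀ {xs v ys} → π ≡ xs ++ v ∷ ys → SumIndecomposable (delete xs v ys) → delete xs v ys ≡ c) → InK1 π
K1-of-unique-child {π = π} π↭ π-indec c unique = π-indec , λ σ τ σ∈K τ∈K → trans (≡c σ∈K) (sym (≡c τ∈K))
  where
  ≡c : ∀ {σ} → InK π σ → σ ≡ c
  ≡c (σ-indec , i , σ≡) with child-view π↭ i
  ... | xs , ys , v , π≡ , child≡ =
    trans (trans σ≡ child≡) (unique π≡ (subst SumIndecomposable (trans σ≡ child≡) σ-indec))

decPerm-K1 : ∀ m → InK1 (decPerm (suc m))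
decPerm-K1 m = K1-of-unique-child (↭-reverse (idPerm (suc m))) indecomposable (decPerm m)
  (λ {xs} {v} {ys} eq _ → delete-decPerm m xs v ys eq)
  where
  indecomposable : SumIndecomposable (decPerm (suc m))
  indecomposable = subst SumIndecomposable (sym (decPerm-suc m))
    (unsplittable⇒indecomposable (λ ()) (unsplittable-head (≤-reflexive (cong suc (length-decPerm m)))))

1⊖idPerm-K1 : ∀ j → InK1 ([ 1 ] ⊖ idPerm (suc (suc j)))
1⊖idPerm-K1 j = subst InK1 (sym ([1]⊖idPerm m))
  (K1-of-unique-child π↭ indecomposable (suc (suc j) ∷ idPerm (suc j)) unique-child)
  where
  m = suc (suc j)
  π↭ : suc m ∷ idPerm m ↭ idPerm (suc m)
  π↭ = ↭-sym (idPerm-↭-max∷ m)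
  indecomposable : SumIndecomposable (suc m ∷ idPerm m)
  indecomposable = unsplittable⇒indecomposable (λ ()) (unsplittable-head (s≤s (≤-reflexive (length-idPerm m))))
  unique-child : ∀ {xs v ys} → suc m ∷ idPerm m ≡ xs ++ v ∷ ys → SumIndecomposable (delete xs v ys) →
    delete xs v ys ≡ m ∷ idPerm (suc j)
  unique-child {[]} refl indec =
    ⊥-elim (idPerm-decomposable j
      (subst SumIndecomposable (map-lower-≤ (All.tabulate (m≤n⇒m≤1+n ∘ proj₂ ∘ ∈-idPerm⁻))) indec))
  unique-child {x ∷ xs} {v} {ys} eq _ with ∷-injective eq
  ... | refl , eq′ = cong₂ _∷_ (lower-> (s≤s v≤m)) (delete-idPerm (suc j) xs v ys eq′)
    where
    v≤m : v ≤ m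
    v≤m = proj₂ (∈-idPerm⁻ (subst (v ∈_) (sym eq′) (∈-++⁺ʳ xs (here refl))))

idPerm⊖1-K1 : ∀ j → InK1 (idPerm (suc (suc j)) ⊖ [ 1 ])
idPerm⊖1-K1 j = subst InK1 (sym (idPerm⊖[1] m))
  (K1-of-unique-child π↭ indecomposable (map suc (idPerm (suc j)) ∷ʳ 1) unique-child)
  where
  m = suc (suc j)
  π↭ : map suc (idPerm m) ∷ʳ 1 ↭ idPerm (suc m)
  π↭ = subst (map suc (idPerm m) ∷ʳ 1 ↭_) (sym (idPerm-suc m)) (++-comm (map suc (idPerm m)) [ 1 ])
  indecomposable : SumIndecomposable (map suc (idPerm m) ∷ʳ 1)
  indecomposable =
    unsplittable⇒indecomposable (∷ʳ≢[] (map suc (idPerm m))) (unsplittable-last {map suc (idPerm m)} ≤-refl)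
  unique-child : ∀ {xs v ys} → map suc (idPerm m) ∷ʳ 1 ≡ xs ++ v ∷ ys → SumIndecomposable (delete xs v ys) →
    delete xs v ys ≡ map suc (idPerm (suc j)) ∷ʳ 1
  unique-child {xs} {v} {ys} eq indec with initLast ys
  ... | [] with ∷ʳ-injective (map suc (idPerm m)) xs eq
  ...   | refl , refl = ⊥-elim (idPerm-decomposable j (subst SumIndecomposable deleted≡ indec))
    where
    deleted≡ : delete (map suc (idPerm m)) 1 [] ≡ idPerm m
    deleted≡ = trans (cong (map (lower 1)) (++-identityʳ (map suc (idPerm m)))) (lower-1-suc-idPerm m)
  unique-child {xs} {v} {_} eq _ | ys ∷ʳ′ y
    with ∷ʳ-injective (map suc (idPerm m)) (xs ++ v ∷ ys) (trans eq (sym (++-assoc xs (v ∷ ys) [ y ])))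
  ... | eq′ , refl with map-suc-split (idPerm m) xs v ys eq′
  ...   | A , B , w , id≡ , refl , refl , refl = begin
    delete (map suc A) (suc w) (map suc B ∷ʳ 1)
      ≡⟨ delete-∷ʳ (map suc A) (suc w) (map suc B) 1 ⟩
    delete (map suc A) (suc w) (map suc B) ∷ʳ lower (suc w) 1
      ≡⟨ cong₂ _∷ʳ_ (delete-map-suc A w B) (lower-≤ {suc w} (s≤s z≤n)) ⟩
    map suc (delete A w B) ∷ʳ 1
      ≡⟨ cong (λ l → map suc l ∷ʳ 1) (delete-idPerm (suc j) A w B id≡) ⟩
    map suc (idPerm (suc j)) ∷ʳ 1
      ∎
    where open ≡-Reasoning

-- Runs of consecutive values

K1-children-agree : ∀ {n π} → π ↭ idPerm n → InK1 π → ∀ {xs v ys us w ws} →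
  π ≡ xs ++ v ∷ ys → π ≡ us ++ w ∷ ws →
  SumIndecomposable (delete xs v ys) → SumIndecomposable (delete us w ws) → delete xs v ys ≡ delete us w ws
K1-children-agree π↭ (_ , atMostOne) π≡ π≡′ indec indec′ with child-deleting π↭ π≡ | child-deleting π↭ π≡′
... | i , child≡ | j , child≡′ = atMostOne _ _ (indec , i , sym child≡) (indec′ , j , sym child≡′)

Consecutive : ℕ → ℕ → Set
Consecutive x y = y ≡ suc x ⊎ x ≡ suc y

consecutive? : ∀ x y → Dec (Consecutive x y)
consecutive? x y = (y ≟ suc x) ⊎-dec (x ≟ suc y)

linked-or-gap : ∀ l → Linked Consecutive l ⊎ ∃₂ λ A B → ∃₂ λ x y → l ≡ A ++ x ∷ y ∷ B × ¬ Consecutive x y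
linked-or-gap [] = inj₁ []
linked-or-gap (x ∷ []) = inj₁ [-]
linked-or-gap (x ∷ y ∷ l) with consecutive? x y | linked-or-gap (y ∷ l)
... | no gap | _ = inj₂ ([] , l , x , y , refl , gap)
... | yes c | inj₁ linked = inj₁ (c ∷ linked)
... | yes _ | inj₂ (A , B , x′ , y′ , eq , gap) = inj₂ (x ∷ A , B , x′ , y′ , cong (x ∷_) eq , gap)

lower-cross : ∀ {x y} → x < y → lower x y ≡ lower y x → y ≡ suc x
lower-cross {x} {y} x<y eq = begin
  y               ≡⟨ sym (suc-pred-> x<y) ⟩
  suc (pred y)    ≡⟨ cong suc (sym (lower-> x<y)) ⟩
  suc (lower x y) ≡⟨ cong suc (trans eq (lower-≤ (<⇒≤ x<y))) ⟩
  suc x           ∎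
  where open ≡-Reasoning

lower-swap-≢ : ∀ {x y} → x ≢ y → ¬ Consecutive x y → lower x y ≢ lower y x
lower-swap-≢ {x} {y} x≢y gap eq with <-cmp x y
... | tri< x<y _ _ = gap (inj₁ (lower-cross x<y eq))
... | tri≈ _ x≡y _ = x≢y x≡y
... | tri> _ _ y<x = gap (inj₂ (lower-cross y<x (sym eq)))

-- The two children agree except at position length A, where they hold lower x y and lower y x.
delete-adjacent-≢ : ∀ A {x y} B → x ≢ y → ¬ Consecutive x y → delete A x (y ∷ B) ≢ delete (A ∷ʳ x) y B
delete-adjacent-≢ A {x} {y} B x≢y gap eq = lower-swap-≢ x≢y gap
  (middle-≡ (map (lower x) A) (map (lower y) A)
    (trans (sym (map-++ (lower x) A (y ∷ B)))
      (trans eq (trans (cong (map (lower y)) (++-assoc A [ x ] B)) (map-++ (lower y) A (x ∷ B)))))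
    (trans (length-map (lower x) A) (sym (length-map (lower y) A))))

K1-segment-consecutive : ∀ {n π} → π ↭ idPerm n → InK1 π → ∀ P τ S → π ≡ P ++ τ ++ S →
  (∀ A x B → τ ≡ A ++ x ∷ B → SumIndecomposable (delete (P ++ A) x (B ++ S))) → Linked Consecutive τ
K1-segment-consecutive {π = π} π↭ K P τ S π≡ indecomposable with linked-or-gap τ
... | inj₁ linked = linked
... | inj₂ (A , B , x , y , refl , gap) = ⊥-elim (delete-adjacent-≢ (P ++ A) (B ++ S) x≢y gap agree)
  where
  π≡x : π ≡ (P ++ A) ++ x ∷ y ∷ B ++ S
  π≡x = trans π≡ (trans (cong (P ++_) (++-assoc A (x ∷ y ∷ B) S)) (sym (++-assoc P A _)))
  π≡y : π ≡ ((P ++ A) ∷ʳ x) ++ y ∷ B ++ S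
  π≡y = trans π≡x (sym (++-assoc (P ++ A) [ x ] _))
  x≢y : x ≢ y
  x≢y x≡y = deleted-∉ π↭ π≡x (∈-++⁺ʳ (P ++ A) (here x≡y))
  agree : delete (P ++ A) x (y ∷ B ++ S) ≡ delete ((P ++ A) ∷ʳ x) y (B ++ S)
  agree = K1-children-agree π↭ K π≡x π≡y (indecomposable A x (y ∷ B) refl)
    (subst (λ Q → SumIndecomposable (delete Q y (B ++ S))) (sym (++-assoc P A [ x ]))
      (indecomposable (A ∷ʳ x) y B (sym (++-assoc A [ x ] (y ∷ B)))))

Ascending Descending : List ℕ → Set
Ascending = Linked (λ x y → y ≡ suc x)
Descending = Linked (λ x y → x ≡ suc y)

-- Turning around would repeat a value two places later.
consecutive-monotone : ∀ {l} → Unique l → Linked Consecutive l → Ascending l ⊎ Descending l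
consecutive-monotone _ [] = inj₁ []
consecutive-monotone _ [-] = inj₁ [-]
consecutive-monotone (_ ∷ u) (c ∷ cs) with c | consecutive-monotone u cs
... | inj₁ up | inj₁ ups = inj₁ (up ∷ ups)
... | inj₂ down | inj₂ downs = inj₂ (down ∷ downs)
... | inj₁ up | inj₂ [-] = inj₁ (up ∷ [-])
... | inj₂ down | inj₁ [-] = inj₂ (down ∷ [-])
consecutive-monotone ((_ ∷ x≢z ∷ _) ∷ _) (_ ∷ _) | inj₁ refl | inj₂ (refl ∷ _) = ⊥-elim (x≢z refl)
consecutive-monotone ((_ ∷ x≢z ∷ _) ∷ _) (_ ∷ _) | inj₂ refl | inj₁ (refl ∷ _) = ⊥-elim (x≢z refl)

ascending⇒increasing : ∀ {l} → Ascending l → Linked _≤_ l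
ascending⇒increasing = Linked.map (λ { refl → n≤1+n _ })

descending⇒decreasing : ∀ {l} → Descending l → Linked _≥_ l
descending⇒decreasing = Linked.map (λ { refl → n≤1+n _ })

K1-starting-max : ∀ {m π τ} → π ↭ idPerm (suc m) → InK1 π → π ≡ suc m ∷ τ →
  π ≡ decPerm (suc m) ⊎ π ≡ [ 1 ] ⊖ idPerm m
K1-starting-max {m} {π} {τ} π↭ K π≡ =
  monotone-case (consecutive-monotone (unique-↭ τ↭ (unique-idPerm m)) consecutive)
  where
  τ↭ : τ ↭ idPerm m
  τ↭ = drop-∷ (↭-trans (subst (_↭ idPerm (suc m)) π≡ π↭) (idPerm-↭-max∷ m))
  child-indecomposable : ∀ A x B → τ ≡ A ++ x ∷ B → SumIndecomposable (delete (suc m ∷ A) x (B ++ []))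
  child-indecomposable A x B τ≡ =
    unsplittable⇒indecomposable (λ ()) (unsplittable-head (subst (_ <_) (sym lower≡m) |σ|<m))
    where
    lower≡m : lower x (suc m) ≡ m
    lower≡m = lower-> (s≤s (proj₂ (∈-perm⁻ τ↭ (subst (x ∈_) (sym τ≡) (∈-++⁺ʳ A (here refl))))))
    |σ|<m : length (delete A x (B ++ [])) < m
    |σ|<m = ≤-reflexive (trans (sym (length-delete A x (B ++ [])))
              (trans (cong length (trans (sym (++-assoc A (x ∷ B) [])) (cong (_++ []) (sym τ≡))))
                (trans (cong length (++-identityʳ τ)) (length-perm τ↭))))
  consecutive : Linked Consecutive τ
  consecutive = K1-segment-consecutive π↭ K [ suc m ] τ []
    (trans π≡ (cong (suc m ∷_) (sym (++-identityʳ τ)))) child-indecomposable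
  open ≡-Reasoning
  monotone-case : Ascending τ ⊎ Descending τ → π ≡ decPerm (suc m) ⊎ π ≡ [ 1 ] ⊖ idPerm m
  monotone-case (inj₁ up) = inj₂ (begin
    π                 ≡⟨ π≡ ⟩
    suc m ∷ τ         ≡⟨ cong (suc m ∷_) (↭-increasing⇒≡ (ascending⇒increasing up) (idPerm-increasing m) τ↭) ⟩
    suc m ∷ idPerm m  ≡⟨ sym ([1]⊖idPerm m) ⟩
    [ 1 ] ⊖ idPerm m  ∎)
  monotone-case (inj₂ down) = inj₁ (begin
    π                  ≡⟨ π≡ ⟩
    suc m ∷ τ          ≡⟨ cong (suc m ∷_) (↭-decreasing⇒≡ (descending⇒decreasing down) (decPerm-decreasing m) τ↭dec) ⟩
    suc m ∷ decPerm m  ≡⟨ sym (decPerm-suc m) ⟩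
    decPerm (suc m)    ∎)
    where τ↭dec = ↭-trans τ↭ (↭-sym (↭-reverse (idPerm m)))

K1-ending-1 : ∀ {m π τ} → π ↭ idPerm (suc m) → InK1 π → π ≡ τ ∷ʳ 1 →
  π ≡ decPerm (suc m) ⊎ π ≡ idPerm m ⊖ [ 1 ]
K1-ending-1 {m} {π} {τ} π↭ K π≡ =
  monotone-case (consecutive-monotone (unique-↭ τ↭ (Unique.map⁺ suc-injective (unique-idPerm m))) consecutive)
  where
  τ↭ : τ ↭ map suc (idPerm m)
  τ↭ = drop-∷ (↭-trans (++-comm [ 1 ] τ)
                 (↭-trans (subst (_↭ idPerm (suc m)) π≡ π↭) (↭-reflexive (idPerm-suc m))))
  child-indecomposable : ∀ A x B → τ ≡ A ++ x ∷ B → SumIndecomposable (delete A x (B ∷ʳ 1))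
  child-indecomposable A x B _ = subst SumIndecomposable (sym (delete-∷ʳ A x B 1))
    (unsplittable⇒indecomposable (∷ʳ≢[] (delete A x B)) (unsplittable-last {delete A x B} (lower-≤-self x 1)))
  consecutive : Linked Consecutive τ
  consecutive = K1-segment-consecutive π↭ K [] τ [ 1 ] π≡ child-indecomposable
  open ≡-Reasoning
  monotone-case : Ascending τ ⊎ Descending τ → π ≡ decPerm (suc m) ⊎ π ≡ idPerm m ⊖ [ 1 ]
  monotone-case (inj₁ up) = inj₂ (begin
    π                          ≡⟨ π≡ ⟩
    τ ∷ʳ 1                     ≡⟨ cong (_∷ʳ 1) (↭-increasing⇒≡ (ascending⇒increasing up) sucs↗ τ↭) ⟩
    map suc (idPerm m) ∷ʳ 1    ≡⟨ sym (idPerm⊖[1] m) ⟩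
    idPerm m ⊖ [ 1 ]           ∎)
    where sucs↗ = Linked.map⁺ (Linked.map s≤s (idPerm-increasing m))
  monotone-case (inj₂ down) = inj₁ (begin
    π                          ≡⟨ π≡ ⟩
    τ ∷ʳ 1                     ≡⟨ cong (_∷ʳ 1) (↭-decreasing⇒≡ (descending⇒decreasing down) sucs↘ τ↭dec) ⟩
    map suc (decPerm m) ∷ʳ 1   ≡⟨ sym (decPerm-suc-∷ʳ m) ⟩
    decPerm (suc m)            ∎)
    where
    sucs↘ = Linked.map⁺ (Linked.map s≤s (decPerm-decreasing m))
    τ↭dec = ↭-trans τ↭ (map⁺ suc (↭-sym (↭-reverse (idPerm m))))

-- A permutation in K⁽¹⁾ starts with n or ends with 1

-- Position length (a ∷ xs) holds lower a y in the first child and lower b v in the second.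
delete-first≢delete-last : ∀ {a} xs {v y ys init b} → (a ∷ xs) ++ v ∷ y ∷ ys ≡ init ∷ʳ b →
  lower a y ≢ lower b v →
  delete [] a (xs ++ v ∷ y ∷ ys) ≢ delete init b []
delete-first≢delete-last {a} xs {v} {y} {ys} {b = b} eq differ first≡last with init-split (a ∷ xs) (y ∷ ys) eq (λ ())
... | Q , refl = differ (middle-≡ (map (lower a) (xs ∷ʳ v)) (map (lower b) (a ∷ xs)) aligned lengths)
  where
  open ≡-Reasoning
  aligned : map (lower a) (xs ∷ʳ v) ++ lower a y ∷ map (lower a) ys
          ≡ map (lower b) (a ∷ xs) ++ lower b v ∷ map (lower b) (Q ++ [])
  aligned = begin
    map (lower a) (xs ∷ʳ v) ++ lower a y ∷ map (lower a) ys ≡⟨ sym (map-++ (lower a) (xs ∷ʳ v) (y ∷ ys)) ⟩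
    map (lower a) ((xs ∷ʳ v) ++ y ∷ ys)                    ≡⟨ cong (map (lower a)) (++-assoc xs [ v ] (y ∷ ys)) ⟩
    map (lower a) (xs ++ v ∷ y ∷ ys)                       ≡⟨ first≡last ⟩
    map (lower b) (((a ∷ xs) ++ v ∷ Q) ++ [])              ≡⟨ cong (map (lower b)) (++-assoc (a ∷ xs) (v ∷ Q) []) ⟩
    map (lower b) ((a ∷ xs) ++ v ∷ Q ++ [])                ≡⟨ map-++ (lower b) (a ∷ xs) (v ∷ Q ++ []) ⟩
    map (lower b) (a ∷ xs) ++ lower b v ∷ map (lower b) (Q ++ []) ∎
  lengths : length (map (lower a) (xs ∷ʳ v)) ≡ length (map (lower b) (a ∷ xs))
  lengths = begin
    length (map (lower a) (xs ∷ʳ v)) ≡⟨ length-map (lower a) (xs ∷ʳ v) ⟩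
    length (xs ∷ʳ v)                 ≡⟨ trans (length-++ xs) (+-comm (length xs) 1) ⟩
    suc (length xs)                  ≡⟨ sym (length-map (lower b) (a ∷ xs)) ⟩
    length (map (lower b) (a ∷ xs))  ∎

-- X, N, F, L delete the entries n, 1, first and last. Which pair of them is indecomposable depends on
-- whether X and N split; in each case the two are told apart by their first, last or a middle entry.
module NoExtremeEnds {m π a xs y ys us ws b} (1≤m : 1 ≤ m) (π↭ : π ↭ idPerm (suc m)) (K : InK1 π)
  (π≡n : π ≡ (a ∷ xs) ++ suc m ∷ y ∷ ys) (π≡1 : π ≡ us ++ 1 ∷ ws ∷ʳ b) where

  private
    n = suc m
    rest = xs ++ n ∷ y ∷ ys
    init = us ++ 1 ∷ ws

    π≡a∷ : π ≡ [] ++ a ∷ rest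
    π≡a∷ = π≡n

    π≡∷b : π ≡ init ++ b ∷ []
    π≡∷b = trans π≡1 (sym (++-assoc us (1 ∷ ws) [ b ]))

    X = delete (a ∷ xs) n (y ∷ ys)
    N = delete us 1 (ws ∷ʳ b)
    F = delete [] a rest
    L = delete init b []

    bounded-⊥ : ∀ {k} → 1 ≤ k → k < n → ¬ All (_≤ k) (take k π)
    bounded-⊥ 1≤k k<n prefix = boundedPrefix⇒decomposable π↭ 1≤k k<n prefix (proj₁ K)

    a≤n : a ≤ n
    a≤n = proj₂ (∈-perm⁻ π↭ (subst (a ∈_) (sym π≡n) (here refl)))

    2≤a : 2 ≤ a
    2≤a = ≤∧≢⇒< (proj₁ (∈-perm⁻ π↭ (subst (a ∈_) (sym π≡n) (here refl))))
            (λ { refl → indecomposable-head≢1 π↭ (proj₁ K) (s≤s 1≤m) π≡n })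

    b≤n : b ≤ n
    b≤n = proj₂ (∈-perm⁻ π↭ (subst (b ∈_) (sym π≡∷b) (∈-++⁺ʳ init (here refl))))

    b<n : b < n
    b<n = ≤∧≢⇒< b≤n (λ { refl → indecomposable-last≢max π↭ (proj₁ K) (s≤s 1≤m) π≡∷b })

    2≤b : 2 ≤ b
    2≤b = ≤∧≢⇒< (proj₁ (∈-perm⁻ π↭ (subst (b ∈_) (sym π≡∷b) (∈-++⁺ʳ init (here refl)))))
            (λ { refl → deleted-∉ π↭ {us} π≡1 (∈-++⁺ʳ us (∈-++⁺ʳ ws (here refl))) })

    y≤m : y ≤ m
    y≤m = s≤s⁻¹ (≤∧≢⇒< (proj₂ (∈-perm⁻ π↭ (subst (y ∈_) (sym π≡n) (∈-++⁺ʳ (a ∷ xs) (there (here refl)))))) y≢n)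
      where
      y≢n : y ≢ n
      y≢n refl = deleted-∉ π↭ {a ∷ xs} π≡n (∈-++⁺ʳ (a ∷ xs) (here refl))

    length-child : ∀ {P v Q} → π ≡ P ++ v ∷ Q → length (delete P v Q) ≡ m
    length-child {P} {v} {Q} π≡ =
      suc-injective (trans (sym (length-delete P v Q)) (trans (cong length (sym π≡)) (length-perm π↭)))

    agree : ∀ {P v Q P′ v′ Q′} → π ≡ P ++ v ∷ Q → π ≡ P′ ++ v′ ∷ Q′ →
      ¬ Splittable (delete P v Q) → ¬ Splittable (delete P′ v′ Q′) → delete P v Q ≡ delete P′ v′ Q′
    agree π≡ π≡′ unsplit unsplit′ =
      K1-children-agree π↭ K π≡ π≡′ (indecomposable π≡ unsplit) (indecomposable π≡′ unsplit′)
      where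
      indecomposable : ∀ {P v Q} → π ≡ P ++ v ∷ Q → ¬ Splittable (delete P v Q) → SumIndecomposable (delete P v Q)
      indecomposable π≡ =
        unsplittable⇒indecomposable (λ σ≡[] → <⇒≢ 1≤m (sym (trans (sym (length-child π≡)) (cong length σ≡[]))))

    X-head : X ≡ a ∷ delete xs n (y ∷ ys)
    X-head = cong (_∷ delete xs n (y ∷ ys)) (lower-≤ a≤n)

    X-last : ∃ λ σ → X ≡ σ ∷ʳ b
    X-last with delete-last (a ∷ xs) (y ∷ ys) (trans (sym π≡∷b) π≡n) (<⇒≢ b<n)
    ... | σ , X≡ = σ , trans X≡ (cong (σ ∷ʳ_) (lower-≤ b≤n))

    N-head : ∃ λ σ → N ≡ pred a ∷ σ
    N-head with delete-head us (trans (sym π≡n) π≡1) (λ { refl → <⇒≱ 2≤a ≤-refl })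
    ... | σ , N≡ = σ , trans N≡ (cong (_∷ σ) (lower-> 2≤a))

    N-last : N ≡ delete us 1 ws ∷ʳ pred b
    N-last = trans (delete-∷ʳ us 1 ws b) (cong (_ ∷ʳ_) (lower-> 2≤b))

    F-last : a < b → ∃ λ σ → F ≡ σ ∷ʳ pred b
    F-last a<b with delete-last [] rest (trans (sym π≡∷b) π≡a∷) (>⇒≢ a<b)
    ... | σ , F≡ = σ , trans F≡ (cong (σ ∷ʳ_) (lower-> a<b))

    L-head : a < b → ∃ λ σ → L ≡ a ∷ σ
    L-head a<b with delete-head init (trans (sym π≡a∷) π≡∷b) (<⇒≢ a<b)
    ... | σ , L≡ = σ , trans L≡ (cong (_∷ σ) (lower-≤ (<⇒≤ a<b)))

    |init| : length init ≡ m
    |init| = trans (cong length (sym (++-identityʳ init)))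
                   (trans (sym (length-map (lower b) (init ++ []))) (length-child {init} π≡∷b))

    -- If L split at k′, then either b > k′ and π itself would split, or n lies beyond position k′ ≥ b > k
    -- and the split of X at k would be one of π.
    L-unsplittable : ∀ {k} → 1 ≤ k → k < m → SplitsAt X k → k < b → ¬ Splittable L
    L-unsplittable {k} 1≤k k<m X-split k<b (k′ , k′<|L| , 1≤k′ , L-prefix , _) with b ≤? k′
    ... | no b≰k′ = bounded-⊥ 1≤k′ (m<n⇒m<1+n k′<m) (subst (All (_≤ k′) ∘ take k′) (sym π≡∷b)
                      (All.map (lower-≤⇒≤ (≰⇒> b≰k′)) init-prefix))
      where
      k′<m = subst (k′ <_) (length-child {init} π≡∷b) k′<|L|
      init-prefix = prefix-before-deleted init b [] L-prefix (subst (k′ ≤_) (sym |init|) (<⇒≤ k′<m))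
    ... | yes b≤k′ = bounded-⊥ 1≤k (m<n⇒m<1+n k<m) (subst (All (_≤ k) ∘ take k) (sym π≡n)
                       (All.map (lower-≤⇒≤ (m<n⇒m<1+n k<m)) X-prefix))
      where
      k′<m = subst (k′ <_) (length-child {init} π≡∷b) k′<|L|
      n∉prefix : All (_≢ n) (take k′ ((a ∷ xs) ++ n ∷ y ∷ ys))
      n∉prefix = subst (All (_≢ n) ∘ take k′) (trans (sym π≡∷b) π≡n)
        (All.map (λ le → <⇒≢ (s≤s (≤-trans (lower-≤⇒≤-suc le) k′<m)))
          (prefix-before-deleted init b [] L-prefix (subst (k′ ≤_) (sym |init|) (<⇒≤ k′<m))))
      k≤|a∷xs| : k ≤ length (a ∷ xs)
      k≤|a∷xs| = ≤-trans (<⇒≤ (<-≤-trans k<b b≤k′)) (take-∌⇒≤-length k′ (a ∷ xs) n∉prefix)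
      X-prefix = prefix-before-deleted (a ∷ xs) n (y ∷ ys) (proj₁ X-split) k≤|a∷xs|

    -- If F split at k′, then either a ≤ k′ + 1 and π would split at k′ + 1, or 1 lies within the
    -- first k′ + 1 entries and the split of N at k would extend to a split of π at k + 1.
    F-unsplittable : ∀ {k} → k < m → SplitsAt N k → a ≤ suc k → ¬ Splittable F
    F-unsplittable {k} k<m N-split a≤sk (k′ , k′<|F| , 1≤k′ , F-prefix , F-suffix) with a ≤? suc k′
    ... | yes a≤sk′ = bounded-⊥ (s≤s z≤n) (s≤s (subst (k′ <_) (length-child {[]} π≡a∷) k′<|F|))
                        (subst (All (_≤ suc k′) ∘ take (suc k′)) (sym π≡a∷)
                          (prefix-with-deleted [] a rest F-prefix z≤n a≤sk′))
    ... | no a≰sk′ = bounded-⊥ (s≤s z≤n) (s≤s k<m) (subst (All (_≤ suc k) ∘ take (suc k)) (sym π≡1)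
                       (prefix-with-deleted us 1 (ws ∷ʳ b) (proj₁ N-split) |us|≤k (s≤s z≤n)))
      where
      1∈rest : 1 ∈ rest
      1∈rest with subst (1 ∈_) π≡a∷ (∈-perm⁺ π↭ ≤-refl (s≤s z≤n))
      ... | here 1≡a = ⊥-elim (<⇒≢ 2≤a 1≡a)
      ... | there 1∈ = 1∈
      1∉suffix : 1 ∉ drop k′ rest
      1∉suffix 1∈ = <⇒≱ (All.lookup (All-map⁻ (subst (All (k′ <_)) (drop-map k′ rest) F-suffix)) 1∈)
                        (subst (_≤ k′) (sym (lower-≤ (<⇒≤ 2≤a))) 1≤k′)
      1∈prefix : 1 ∈ take k′ rest
      1∈prefix with ∈-++⁻ (take k′ rest) (subst (1 ∈_) (sym (take++drop≡id k′ rest)) 1∈rest)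
      ... | inj₁ 1∈ = 1∈
      ... | inj₂ 1∈ = ⊥-elim (1∉suffix 1∈)
      |us|<sk′ : length us < suc k′
      |us|<sk′ = take-∋⇒length-< (suc k′) us (deleted-∉ π↭ {us} π≡1 ∘ ∈-++⁺ˡ)
                   (subst (1 ∈_) (cong (take (suc k′)) (trans (sym π≡a∷) π≡1)) (there 1∈prefix))
      |us|≤k : length us ≤ k
      |us|≤k = ≤-trans (s≤s⁻¹ |us|<sk′) (s≤s⁻¹ (≤-trans (<⇒≤ (≰⇒> a≰sk′)) a≤sk))

    X-split : Splittable X → a < b × a < m × ¬ Splittable L
    X-split (k , k<|X| , 1≤k , split) with X-last
    ... | σ , X≡ = ≤-<-trans a≤k k<b , ≤-<-trans a≤k k<m , L-unsplittable 1≤k k<m split k<b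
      where
      k<m = subst (k <_) (length-child {a ∷ xs} π≡n) k<|X|
      a≤k = subst (_≤ k) (lower-≤ a≤n) (splitsAt-head 1≤k split)
      k<b = splitsAt-last (subst (k <_) (cong length X≡) k<|X|) (subst (λ σ → SplitsAt σ k) X≡ split)

    N-split : Splittable N → a < b × ¬ Splittable F
    N-split (k , k<|N| , 1≤k , split) with N-head
    ... | σ , N≡ = ≤-<-trans a≤sk sk<b , F-unsplittable k<m split a≤sk
      where
      k<m = subst (k <_) (length-child {us} π≡1) k<|N|
      a≤sk = subst (_≤ suc k) (suc-pred-> 2≤a) (s≤s (splitsAt-head 1≤k (subst (λ σ → SplitsAt σ k) N≡ split)))
      sk<b = subst (suc k <_) (suc-pred-> 2≤b)
               (s≤s (splitsAt-last (subst (k <_) (cong length N-last) k<|N|) (subst (λ σ → SplitsAt σ k) N-last split)))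

    X≢N : X ≢ N
    X≢N X≡N with N-head
    ... | σ , N≡ = <⇒≢ (pred-< (<⇒≤ 2≤a)) (sym (proj₁ (∷-injective (trans (sym X-head) (trans X≡N N≡)))))

    N≢L : a < b → N ≢ L
    N≢L a<b N≡L with N-head | L-head a<b
    ... | σ , N≡ | σ′ , L≡ = <⇒≢ (pred-< (<⇒≤ 2≤a)) (proj₁ (∷-injective (trans (sym N≡) (trans N≡L L≡))))

    F≢X : a < b → F ≢ X
    F≢X a<b F≡X with F-last a<b | X-last
    ... | σ , F≡ | σ′ , X≡ = <⇒≢ (pred-< (<⇒≤ 2≤b)) (∷ʳ-injectiveʳ σ σ′ (trans (sym F≡) (trans F≡X X≡)))

    F≢L : a < m → F ≢ L
    F≢L a<m = delete-first≢delete-last xs (trans (sym π≡n) π≡∷b)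
      (λ lower≡ → <⇒≢ (lower-< a<m y≤m) (trans lower≡ (lower-> b<n)))

  contradiction : ⊥
  contradiction with splittable? X | splittable? N
  ... | no ¬sX | no ¬sN = X≢N (agree {a ∷ xs} {P′ = us} π≡n π≡1 ¬sX ¬sN)
  ... | yes sX | no ¬sN = let a<b , _ , ¬sL = X-split sX in
    N≢L a<b (agree {us} {P′ = init} π≡1 π≡∷b ¬sN ¬sL)
  ... | no ¬sX | yes sN = let a<b , ¬sF = N-split sN in
    F≢X a<b (agree {[]} {P′ = a ∷ xs} π≡a∷ π≡n ¬sF ¬sX)
  ... | yes sX | yes sN = let _ , a<m , ¬sL = X-split sX ; _ , ¬sF = N-split sN in
    F≢L a<m (agree {[]} {P′ = init} π≡a∷ π≡∷b ¬sF ¬sL)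

K1-extreme-end : ∀ {m π} → 1 ≤ m → π ↭ idPerm (suc m) → InK1 π →
  (∃ λ τ → π ≡ suc m ∷ τ) ⊎ (∃ λ τ → π ≡ τ ∷ʳ 1)
K1-extreme-end {m} 1≤m π↭ K
  with ∈-∃++ (∈-perm⁺ π↭ (s≤s z≤n) ≤-refl) | ∈-∃++ (∈-perm⁺ π↭ ≤-refl (s≤s z≤n))
... | [] , τ , π≡ | _ = inj₁ (τ , π≡)
... | a ∷ xs , [] , π≡ | _ = ⊥-elim (indecomposable-last≢max π↭ (proj₁ K) (s≤s 1≤m) {a ∷ xs} π≡)
... | a ∷ xs , y ∷ ys , π≡n | us , ws , π≡1 with initLast ws
...   | [] = inj₂ (us , π≡1)
...   | ws′ ∷ʳ′ b = ⊥-elim (NoExtremeEnds.contradiction 1≤m π↭ K π≡n π≡1)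

proposition4p3 : (n : ℕ) → 3 ≤ n → (π : List ℕ) → IsPerm n π →
    (InK1 π ⇔ (π ≡ decPerm n ⊎ (π ≡ (1 ∷ []) ⊖ idPerm (n ∸ 1) ⊎ π ≡ idPerm (n ∸ 1) ⊖ (1 ∷ []))))
proposition4p3 (suc (suc (suc j))) (s≤s (s≤s (s≤s _))) π π↭ = mk⇔ classify members
  where
  m = suc (suc j)
  classify : InK1 π → π ≡ decPerm (suc m) ⊎ (π ≡ [ 1 ] ⊖ idPerm m ⊎ π ≡ idPerm m ⊖ [ 1 ])
  classify K with K1-extreme-end (s≤s z≤n) π↭ K
  ... | inj₁ (_ , π≡) = Sum.map₂ inj₁ (K1-starting-max π↭ K π≡)
  ... | inj₂ (_ , π≡) = Sum.map₂ inj₂ (K1-ending-1 π↭ K π≡)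
  members : π ≡ decPerm (suc m) ⊎ (π ≡ [ 1 ] ⊖ idPerm m ⊎ π ≡ idPerm m ⊖ [ 1 ]) → InK1 π
  members (inj₁ refl) = decPerm-K1 m
  members (inj₂ (inj₁ refl)) = 1⊖idPerm-K1 j
  members (inj₂ (inj₂ refl)) = idPerm⊖1-K1 j
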